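{- For each integer $d\ge 9$ there exists a finite poset $P$ on $[d]$ such that the chain polytope $\mathcal{C}(P)$ is not unimodularly equivalent to the order polytope $\mathcal{O}(Q)$ of any finite poset $Q$.
   Context: For a finite poset $(P,\preccurlyeq)$ on $[d]$: the order polytope $\mathcal{O}(P)$ is the set of $x\in\mathbb{R}^d$ with $0\le x_i\le 1$ for all $i$ and $x_i\ge x_j$ whenever $i\preccurlyeq j$ in $P$. The chain polytope $\mathcal{C}(P)$ is the set of $x\in\mathbb{R}^d$ with $x_i\ge 0$ for all $i$ and $x_{i_1}+\dots+x_{i_k}\le 1$ for every maximal chain $i_1\prec\dots\prec i_k$ of $P$. Two polytopes in $\mathbb{R}^d$ are unimodularly equivalent if there is an affine map $x\mapsto Ux+b$ with $U\in GL_d(\mathbb{Z})$, $b\in\mathbb{Z}^d$, mapping one onto the other.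
   Formalization: The polytopes $\mathcal{C}(P)$ and $\mathcal{O}(Q)$ are replaced by their sets of points with rational coordinates, taken in ℚ^d instead of $\mathbb{R}^d$. -}

module Defs where

open import Level using (0ℓ)
open import Data.Nat using (ℕ; zero; suc)
open import Data.Fin using (Fin; zero; suc)
open import Data.Bool using (Bool; true; false)
open import Data.Integer using (ℤ; +_)
open import Data.Rational using (ℚ; 0ℚ; 1ℚ; _+_; _*_; _≤_; _/_)
open import Data.Product using (Σ; _×_; ∃)
open import Data.Sum using (_⊎_)
open import Relation.Binary using (IsPartialOrder)
open import Relation.Binary.PropositionalEquality using (_≡_)

record FinPoset (d : ℕ) : Set₁ where
  field
    _≼_ : Fin d → Fin d → Set
    isPartialOrder : IsPartialOrder _≡_ _≼_

-- Points of ℚ^d.  (Both polytopes are rational, and integral affine maps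
-- preserve ℚ^d, so equality of images over ℝ is equivalent to equality of
-- the rational points.)
Point : ℕ → Set
Point d = Fin d → ℚ

∑ : ∀ {d} → (Fin d → ℚ) → ℚ
∑ {zero}  f = 0ℚ
∑ {suc d} f = f zero + ∑ (λ i → f (suc i))

ℤ→ℚ : ℤ → ℚ
ℤ→ℚ z = z / 1

sel : Bool → ℚ → ℚ
sel true  q = q
sel false q = 0ℚ

module _ {d : ℕ} (P : FinPoset d) where
  open FinPoset P

  Comparable : Fin d → Fin d → Set
  Comparable i j = i ≼ j ⊎ j ≼ i

  IsChain : (Fin d → Bool) → Set
  IsChain C = ∀ i j → C i ≡ true → C j ≡ true → Comparable i j

  IsMaximalChain : (Fin d → Bool) → Set
  IsMaximalChain C = IsChain C ×
    (∀ j → (∀ i → C i ≡ true → Comparable i j) → C j ≡ true)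

  InOrderPolytope : Point d → Set
  InOrderPolytope x = (∀ i → (0ℚ ≤ x i) × (x i ≤ 1ℚ)) ×
                      (∀ i j → i ≼ j → x j ≤ x i)

  InChainPolytope : Point d → Set
  InChainPolytope x = (∀ i → 0ℚ ≤ x i) ×
                      (∀ C → IsMaximalChain C → ∑ (λ i → sel (C i) (x i)) ≤ 1ℚ)

Matrix : ℕ → Set
Matrix d = Fin d → Fin d → ℤ

open import Data.Integer using () renaming (_+_ to _+ℤ_; _*_ to _*ℤ_)

∑ℤ : ∀ {d} → (Fin d → ℤ) → ℤ
∑ℤ {zero}  f = + 0
∑ℤ {suc d} f = f zero +ℤ ∑ℤ (λ i → f (suc i))

_⊗_ : ∀ {d} → Matrix d → Matrix d → Matrix d
(U ⊗ V) i k = ∑ℤ (λ j → U i j *ℤ V j k)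

δ : ∀ {d} → Fin d → Fin d → ℤ
δ zero    zero    = + 1
δ zero    (suc _) = + 0
δ (suc _) zero    = + 0
δ (suc i) (suc j) = δ i j

IdMatrix : ∀ {d} → Matrix d
IdMatrix = δ

InGL : ∀ {d} → Matrix d → Set
InGL {d} U = Σ (Matrix d) λ V → (∀ i j → (U ⊗ V) i j ≡ IdMatrix i j)
                               × (∀ i j → (V ⊗ U) i j ≡ IdMatrix i j)

affine : ∀ {d} → Matrix d → (Fin d → ℤ) → Point d → Point d
affine U b x i = ∑ (λ j → ℤ→ℚ (U i j) * x j) + ℤ→ℚ (b i)

MapsOnto : ∀ {d} → (Point d → Point d) → (Point d → Set) → (Point d → Set) → Set
MapsOnto {d} f A B = (∀ x → A x → B (f x)) ×
                     (∀ y → B y → Σ (Point d) λ x → A x × (∀ i → f x i ≡ y i))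

UnimodularlyEquivalent : ∀ {d} → (Point d → Set) → (Point d → Set) → Set
UnimodularlyEquivalent {d} A B =
  Σ (Matrix d) λ U → Σ (Fin d → ℤ) λ b → InGL U × MapsOnto (affine U b) A B

-- Take for P the ordinal sum of three antichains of balanced sizes a, b, c.  Each of its
-- a·b·c maximal chains C gives a facet ∑_{i ∈ C} x_i ≤ 1 of 𝒞(P) missing the vertex 0.
-- Suppose x ↦ Ux + b maps 𝒞(P) onto 𝒪(Q).  It sends lattice points to lattice points, that
-- is to indicator vectors 𝟙 D of down-sets D of Q, and 0 to some 𝟙 B.  Transported to 𝒪(Q),
-- the chain inequality of C becomes an affine function H that is ≥ 0 on every 𝟙 D and equals
-- 1 at 𝟙 B.  The down-sets on which H vanishes form a sublattice; this forces the face
-- {H = 0} into one of the hyperplanes y_j = 0 (j maximal), y_i = 1 (i minimal) or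
-- y_i = y_j (i ≺ j), since otherwise H vanishes at every vertex.  That hyperplane misses 𝟙 B
-- and determines C, which yields a·b·c distinct inequalities of 𝒪(Q) that are strict at 𝟙 B.
-- Coding them by pairs (an element of B, an element outside B) shows that there are at most
-- max(d, kl + 1) of them, where k = |B| and l = d − k; for balanced a, b, c this is < a·b·c.
-- The order of Q need not be decidable, so the argument runs in the double-negation monad.

module Submission where

open import Defs
open import Data.Nat using (ℕ; zero; suc)
open import Data.Fin using (Fin)
open import Data.Integer using (ℤ)
open import Relation.Binary using (Decidable)
open import Relation.Binary.PropositionalEquality using (_≡_; refl)

module Sums where

  open import Data.Fin using (zero; suc)
  open import Data.Rational using (ℚ; 0ℚ; _+_; _*_; -_; _≤_)
  import Data.Rational.Properties as ℚ
  open import Algebra.Bundles using (CommutativeRing)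
  open import Algebra.Properties.Semiring.Sum (CommutativeRing.semiring ℚ.+-*-commutativeRing) as Sum
    using (sum)
  open import Function using (_∘_)
  open import Relation.Binary.PropositionalEquality

  ∑≡sum : ∀ {d} (f : Fin d → ℚ) → ∑ f ≡ sum f
  ∑≡sum {zero}  f = refl
  ∑≡sum {suc d} f = cong (_+_ (f zero)) (∑≡sum (f ∘ suc))

  ∑-cong : ∀ {d} {f g : Fin d → ℚ} → (∀ i → f i ≡ g i) → ∑ f ≡ ∑ g
  ∑-cong {zero}  f≗g = refl
  ∑-cong {suc d} f≗g = cong₂ _+_ (f≗g zero) (∑-cong (f≗g ∘ suc))

  ∑-zero : ∀ d → ∑ {d} (λ _ → 0ℚ) ≡ 0ℚ
  ∑-zero d rewrite ∑≡sum {d} (λ _ → 0ℚ) = Sum.sum-replicate-zero d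

  ∑-distrib-+ : ∀ {d} (f g : Fin d → ℚ) → ∑ (λ i → f i + g i) ≡ ∑ f + ∑ g
  ∑-distrib-+ f g rewrite ∑≡sum (λ i → f i + g i) | ∑≡sum f | ∑≡sum g = Sum.∑-distrib-+ f g

  ∑-comm : ∀ {d e} (f : Fin d → Fin e → ℚ) → ∑ (λ i → ∑ (f i)) ≡ ∑ (λ j → ∑ (λ i → f i j))
  ∑-comm f = begin
    ∑ (λ i → ∑ (f i))              ≡⟨ ∑-cong (λ i → ∑≡sum (f i)) ⟩
    ∑ (λ i → sum (f i))            ≡⟨ ∑≡sum (λ i → sum (f i)) ⟩
    sum (λ i → sum (f i))          ≡⟨ Sum.∑-comm f ⟩
    sum (λ j → sum (λ i → f i j))  ≡˘⟨ ∑≡sum (λ j → sum (λ i → f i j)) ⟩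
    ∑ (λ j → sum (λ i → f i j))    ≡˘⟨ ∑-cong (λ j → ∑≡sum (λ i → f i j)) ⟩
    ∑ (λ j → ∑ (λ i → f i j))      ∎
    where open ≡-Reasoning

  *-distribˡ-∑ : ∀ {d} (x : ℚ) (f : Fin d → ℚ) → x * ∑ f ≡ ∑ (λ i → x * f i)
  *-distribˡ-∑ x f rewrite ∑≡sum f | ∑≡sum (λ i → x * f i) = Sum.*-distribˡ-sum x f

  ∑-neg : ∀ {d} (f : Fin d → ℚ) → ∑ (λ i → - f i) ≡ - ∑ f
  ∑-neg {zero}  f = refl
  ∑-neg {suc d} f = trans (cong (_+_ (- f zero)) (∑-neg (f ∘ suc))) (sym (ℚ.neg-distrib-+ (f zero) _))

  nonneg-sum≡0ˡ : ∀ {a b} → 0ℚ ≤ a → 0ℚ ≤ b → a + b ≡ 0ℚ → a ≡ 0ℚ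
  nonneg-sum≡0ˡ {a} {b} 0≤a 0≤b a+b≡0 = ℚ.≤-antisym a≤0 0≤a
    where
    open ℚ.≤-Reasoning
    a≤0 : a ≤ 0ℚ
    a≤0 = begin
      a       ≡˘⟨ ℚ.+-identityʳ a ⟩
      a + 0ℚ  ≤⟨ ℚ.+-monoʳ-≤ a 0≤b ⟩
      a + b   ≡⟨ a+b≡0 ⟩
      0ℚ      ∎

  nonneg-sum≡0ʳ : ∀ {a b} → 0ℚ ≤ a → 0ℚ ≤ b → a + b ≡ 0ℚ → b ≡ 0ℚ
  nonneg-sum≡0ʳ {a} {b} 0≤a 0≤b a+b≡0 = nonneg-sum≡0ˡ 0≤b 0≤a (trans (ℚ.+-comm b a) a+b≡0)

module IntegerPoints where

  import Data.Nat as ℕ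
  open import Data.Fin using (zero; suc)
  open import Data.Integer as ℤ using (+_; -[1+_])
  import Data.Integer.Properties as ℤ
  open import Data.Rational using (0ℚ; 1ℚ; _+_; _*_; _≤_; *≤*; -_; mkℚ)
  import Data.Rational.Properties as ℚ
  import Data.Nat.Coprimality as Coprime
  open import Data.Sum using (_⊎_; inj₁; inj₂)
  open import Function using (_∘_)
  open import Relation.Binary.PropositionalEquality
  open import Relation.Nullary using (contradiction)
  open Sums

  ℤ→ℚ≡mkℚ : ∀ z → ℤ→ℚ z ≡ mkℚ z 0 (Coprime.sym (Coprime.1-coprimeTo ℤ.∣ z ∣))
  ℤ→ℚ≡mkℚ (+ n)    = ℚ.normalize-coprime (Coprime.sym (Coprime.1-coprimeTo n))
  ℤ→ℚ≡mkℚ -[1+ n ] = cong -_ (ℚ.normalize-coprime (Coprime.sym (Coprime.1-coprimeTo (suc n))))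

  ℤ→ℚ-homo-+ : ∀ m n → ℤ→ℚ (m ℤ.+ n) ≡ ℤ→ℚ m + ℤ→ℚ n
  ℤ→ℚ-homo-+ m n rewrite ℤ→ℚ≡mkℚ m | ℤ→ℚ≡mkℚ n =
    cong ℤ→ℚ (cong₂ ℤ._+_ (sym (ℤ.*-identityʳ m)) (sym (ℤ.*-identityʳ n)))

  ℤ→ℚ-homo-* : ∀ m n → ℤ→ℚ (m ℤ.* n) ≡ ℤ→ℚ m * ℤ→ℚ n
  ℤ→ℚ-homo-* m n rewrite ℤ→ℚ≡mkℚ m | ℤ→ℚ≡mkℚ n = refl

  ℤ→ℚ-homo-∑ : ∀ {d} (f : Fin d → ℤ) → ℤ→ℚ (∑ℤ f) ≡ ∑ (ℤ→ℚ ∘ f)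
  ℤ→ℚ-homo-∑ {ℕ.zero}  f = refl
  ℤ→ℚ-homo-∑ {ℕ.suc d} f = trans (ℤ→ℚ-homo-+ (f zero) _) (cong (_+_ (ℤ→ℚ (f zero))) (ℤ→ℚ-homo-∑ (f ∘ suc)))

  ℤ→ℚ-homo-dot : ∀ {d} (u v : Fin d → ℤ) →
                 ℤ→ℚ (∑ℤ (λ j → u j ℤ.* v j)) ≡ ∑ (λ j → ℤ→ℚ (u j) * ℤ→ℚ (v j))
  ℤ→ℚ-homo-dot u v = trans (ℤ→ℚ-homo-∑ (λ j → u j ℤ.* v j)) (∑-cong (λ j → ℤ→ℚ-homo-* (u j) (v j)))

  ℤ→ℚ-∈[0,1] : ∀ n → 0ℚ ≤ ℤ→ℚ n → ℤ→ℚ n ≤ 1ℚ → n ≡ + 0 ⊎ n ≡ + 1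
  ℤ→ℚ-∈[0,1] n rewrite ℤ→ℚ≡mkℚ n = cases n
    where
    cases : ∀ n → let q = mkℚ n 0 (Coprime.sym (Coprime.1-coprimeTo ℤ.∣ n ∣)) in
            0ℚ ≤ q → q ≤ 1ℚ → n ≡ + 0 ⊎ n ≡ + 1
    cases (+ 0)          _        _                          = inj₁ refl
    cases (+ 1)          _        _                          = inj₂ refl
    cases (+ suc (suc k)) _       (*≤* (ℤ.+≤+ (ℕ.s≤s ())))
    cases -[1+ k ]       (*≤* ()) _

  e : ∀ {d} → Fin d → Point d
  e c i = ℤ→ℚ (δ c i)

  ∑-e* : ∀ {d} (c : Fin d) (x : Point d) → ∑ (λ i → e c i * x i) ≡ x c
  ∑-e* {ℕ.suc d} zero    x = trans (cong₂ _+_ (ℚ.*-identityˡ (x zero))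
                                 (trans (∑-cong (λ i → ℚ.*-zeroˡ (x (suc i)))) (∑-zero d)))
                                 (ℚ.+-identityʳ (x zero))
  ∑-e* {ℕ.suc d} (suc c) x = trans (cong₂ _+_ (ℚ.*-zeroˡ (x zero)) (∑-e* c (x ∘ suc)))
                                 (ℚ.+-identityˡ (x (suc c)))

  e-diag : ∀ {d} (i : Fin d) → e i i ≡ 1ℚ
  e-diag zero    = refl
  e-diag (suc i) = e-diag i

  e-off : ∀ {d} {i j : Fin d} → i ≢ j → e i j ≡ 0ℚ
  e-off {i = zero}  {zero}  i≢j = contradiction refl i≢j
  e-off {i = zero}  {suc j} i≢j = refl
  e-off {i = suc i} {zero}  i≢j = refl
  e-off {i = suc i} {suc j} i≢j = e-off (i≢j ∘ cong suc)

  0≤e : ∀ {d} (c i : Fin d) → 0ℚ ≤ e c i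
  0≤e zero    zero    = ℚ.nonNegative⁻¹ 1ℚ
  0≤e zero    (suc i) = ℚ.≤-refl
  0≤e (suc c) zero    = ℚ.≤-refl
  0≤e (suc c) (suc i) = 0≤e c i

  ∑-*e : ∀ {d} (c : Fin d) (x : Point d) → ∑ (λ i → x i * e c i) ≡ x c
  ∑-*e c x = trans (∑-cong (λ i → ℚ.*-comm (x i) (e c i))) (∑-e* c x)

module AffineFunctions where

  import Data.Integer as ℤ
  open import Data.Rational using (ℚ; 0ℚ; _+_; _*_; -_)
  import Data.Rational.Properties as ℚ
  open import Data.Rational.Solver using (module +-*-Solver)
  open import Function using (_∘_)
  open import Relation.Binary.PropositionalEquality
  open ≡-Reasoning
  open Sums
  open IntegerPoints

  record AffineFunction (d : ℕ) : Set where
    field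
      const : ℚ
      coeff : Fin d → ℚ
  open AffineFunction public

  ⟦_⟧ : ∀ {d} → AffineFunction d → Point d → ℚ
  ⟦ A ⟧ x = const A + ∑ (λ p → coeff A p * x p)

  module _ {d} (A : AffineFunction d) where

    ⟦⟧-cong : ∀ {x y : Point d} → (∀ p → x p ≡ y p) → ⟦ A ⟧ x ≡ ⟦ A ⟧ y
    ⟦⟧-cong x≗y = cong (_+_ (const A)) (∑-cong (λ p → cong (_*_ (coeff A p)) (x≗y p)))

    ⟦⟧-constant : (∀ p → coeff A p ≡ 0ℚ) → ∀ x → ⟦ A ⟧ x ≡ const A
    ⟦⟧-constant coeff≡0 x = begin
      const A + ∑ (λ p → coeff A p * x p)  ≡⟨ cong (_+_ (const A)) (∑-cong (λ p → cong (_* x p) (coeff≡0 p))) ⟩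
      const A + ∑ (λ p → 0ℚ * x p)         ≡⟨ cong (_+_ (const A)) (∑-cong (λ p → ℚ.*-zeroˡ (x p))) ⟩
      const A + ∑ {d} (λ _ → 0ℚ)           ≡⟨ cong (_+_ (const A)) (∑-zero d) ⟩
      const A + 0ℚ                         ≡⟨ ℚ.+-identityʳ (const A) ⟩
      const A                              ∎

    ⟦⟧-zero : ⟦ A ⟧ (λ _ → 0ℚ) ≡ const A
    ⟦⟧-zero = trans (cong (_+_ (const A)) (trans (∑-cong (λ p → ℚ.*-zeroʳ (coeff A p))) (∑-zero d)))
                    (ℚ.+-identityʳ (const A))

    ⟦⟧-+ : ∀ x y → ⟦ A ⟧ (λ i → x i + y i) + const A ≡ ⟦ A ⟧ x + ⟦ A ⟧ y
    ⟦⟧-+ x y = begin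
      (c + ∑ (λ p → coeff A p * (x p + y p))) + c
        ≡⟨ cong (λ s → (c + s) + c) (∑-cong (λ p → ℚ.*-distribˡ-+ (coeff A p) (x p) (y p))) ⟩
      (c + ∑ (λ p → coeff A p * x p + coeff A p * y p)) + c
        ≡⟨ cong (λ s → (c + s) + c) (∑-distrib-+ {d} _ _) ⟩
      (c + (∑ (λ p → coeff A p * x p) + ∑ (λ p → coeff A p * y p))) + c
        ≡⟨ rearrange c _ _ ⟩
      ⟦ A ⟧ x + ⟦ A ⟧ y
        ∎
      where
      c = const A
      open +-*-Solver using (solve; _:+_; _:=_)
      rearrange : ∀ c u v → (c + (u + v)) + c ≡ (c + u) + (c + v)
      rearrange = solve 3 (λ c u v → (c :+ (u :+ v)) :+ c := (c :+ u) :+ (c :+ v)) refl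

    ⟦⟧-+e : ∀ x p → ⟦ A ⟧ (λ i → x i + e p i) ≡ ⟦ A ⟧ x + coeff A p
    ⟦⟧-+e x p = begin
      const A + ∑ (λ i → coeff A i * (x i + e p i))
        ≡⟨ cong (_+_ (const A)) (∑-cong (λ i → ℚ.*-distribˡ-+ (coeff A i) (x i) (e p i))) ⟩
      const A + ∑ (λ i → coeff A i * x i + coeff A i * e p i)
        ≡⟨ cong (_+_ (const A)) (∑-distrib-+ {d} _ _) ⟩
      const A + (∑ (λ i → coeff A i * x i) + ∑ (λ i → coeff A i * e p i))
        ≡⟨ cong (λ s → const A + (∑ (λ i → coeff A i * x i) + s)) (∑-*e p (coeff A)) ⟩
      const A + (∑ (λ i → coeff A i * x i) + coeff A p)
        ≡˘⟨ ℚ.+-assoc (const A) _ (coeff A p) ⟩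
      ⟦ A ⟧ x + coeff A p
        ∎

    ⟦⟧-e : ∀ p → ⟦ A ⟧ (e p) ≡ const A + coeff A p
    ⟦⟧-e p = cong (_+_ (const A)) (∑-*e p (coeff A))

    ⟦⟧-e+e : ∀ c p → ⟦ A ⟧ (λ i → e c i + e p i) ≡ (const A + coeff A c) + coeff A p
    ⟦⟧-e+e c p = trans (⟦⟧-+e (e c) p) (cong (_+ coeff A p) (⟦⟧-e c))

  ⟦⟧-cong-coeff : ∀ {d} (A B : AffineFunction d) → const A ≡ const B → (∀ p → coeff A p ≡ coeff B p) →
         ∀ x → ⟦ A ⟧ x ≡ ⟦ B ⟧ x
  ⟦⟧-cong-coeff A B const≡ coeff≡ x = cong₂ _+_ const≡ (∑-cong (λ p → cong (_* x p) (coeff≡ p)))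

  AffineMap : ℕ → Set
  AffineMap d = Fin d → AffineFunction d

  _∘ᵃ_ : ∀ {d} → AffineFunction d → AffineMap d → AffineFunction d
  A ∘ᵃ M = record
    { const = const A + ∑ (λ k → coeff A k * const (M k))
    ; coeff = λ p → ∑ (λ k → coeff A k * coeff (M k) p)
    }

  ⟦∘ᵃ⟧ : ∀ {d} (A : AffineFunction d) (M : AffineMap d) x → ⟦ A ∘ᵃ M ⟧ x ≡ ⟦ A ⟧ (λ k → ⟦ M k ⟧ x)
  ⟦∘ᵃ⟧ {d} A M x = sym (begin
    const A + ∑ (λ k → a k * (c k + ∑ (λ p → m k p * x p)))
      ≡⟨ cong (_+_ (const A)) (∑-cong (λ k → ℚ.*-distribˡ-+ (a k) (c k) _)) ⟩
    const A + ∑ (λ k → a k * c k + a k * ∑ (λ p → m k p * x p))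
      ≡⟨ cong (_+_ (const A)) (∑-distrib-+ {d} _ _) ⟩
    const A + (∑ (λ k → a k * c k) + ∑ (λ k → a k * ∑ (λ p → m k p * x p)))
      ≡˘⟨ ℚ.+-assoc (const A) _ _ ⟩
    const (A ∘ᵃ M) + ∑ (λ k → a k * ∑ (λ p → m k p * x p))
      ≡⟨ cong (_+_ (const (A ∘ᵃ M))) linear-part ⟩
    const (A ∘ᵃ M) + ∑ (λ p → coeff (A ∘ᵃ M) p * x p)
      ∎)
    where
    a = coeff A
    c = const ∘ M
    m = coeff ∘ M
    linear-part : ∑ (λ k → a k * ∑ (λ p → m k p * x p)) ≡ ∑ (λ p → ∑ (λ k → a k * m k p) * x p)
    linear-part = begin
      ∑ (λ k → a k * ∑ (λ p → m k p * x p))    ≡⟨ ∑-cong (λ k → *-distribˡ-∑ {d} (a k) _) ⟩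
      ∑ (λ k → ∑ (λ p → a k * (m k p * x p)))  ≡⟨ ∑-comm (λ k p → a k * (m k p * x p)) ⟩
      ∑ (λ p → ∑ (λ k → a k * (m k p * x p)))  ≡˘⟨ ∑-cong (λ p → ∑-cong (λ k → ℚ.*-assoc (a k) (m k p) (x p))) ⟩
      ∑ (λ p → ∑ (λ k → a k * m k p * x p))    ≡⟨ ∑-cong (λ p → ∑-cong (λ k → ℚ.*-comm (a k * m k p) (x p))) ⟩
      ∑ (λ p → ∑ (λ k → x p * (a k * m k p)))  ≡˘⟨ ∑-cong (λ p → *-distribˡ-∑ {d} (x p) _) ⟩
      ∑ (λ p → x p * ∑ (λ k → a k * m k p))    ≡⟨ ∑-cong (λ p → ℚ.*-comm (x p) _) ⟩
      ∑ (λ p → ∑ (λ k → a k * m k p) * x p)    ∎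

  rows : ∀ {d} → Matrix d → (Fin d → ℤ) → AffineMap d
  rows U b k = record { const = ℤ→ℚ (b k) ; coeff = λ j → ℤ→ℚ (U k j) }

  affine≡⟦rows⟧ : ∀ {d} (U : Matrix d) b x k → affine U b x k ≡ ⟦ rows U b k ⟧ x
  affine≡⟦rows⟧ U b x k = ℚ.+-comm _ (ℤ→ℚ (b k))

  affine-integral : ∀ {d} (U : Matrix d) b {x : Point d} (z : Fin d → ℤ) → (∀ j → x j ≡ ℤ→ℚ (z j)) →
                    ∀ k → affine U b x k ≡ ℤ→ℚ (∑ℤ (λ j → U k j ℤ.* z j) ℤ.+ b k)
  affine-integral U b {x} z x≡z k = begin
    ∑ (λ j → ℤ→ℚ (U k j) * x j) + ℤ→ℚ (b k)
      ≡⟨ cong (_+ ℤ→ℚ (b k)) (∑-cong (λ j → cong (_*_ (ℤ→ℚ (U k j))) (x≡z j))) ⟩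
    ∑ (λ j → ℤ→ℚ (U k j) * ℤ→ℚ (z j)) + ℤ→ℚ (b k)
      ≡˘⟨ cong (_+ ℤ→ℚ (b k)) (ℤ→ℚ-homo-dot (U k) z) ⟩
    ℤ→ℚ (∑ℤ (λ j → U k j ℤ.* z j)) + ℤ→ℚ (b k)
      ≡˘⟨ ℤ→ℚ-homo-+ (∑ℤ (λ j → U k j ℤ.* z j)) (b k) ⟩
    ℤ→ℚ (∑ℤ (λ j → U k j ℤ.* z j) ℤ.+ b k)
      ∎

  inverseRows : ∀ {d} → Matrix d → (Fin d → ℤ) → AffineMap d
  inverseRows V b k = record
    { const = - ∑ (λ j → ℤ→ℚ (V k j) * ℤ→ℚ (b j))
    ; coeff = λ j → ℤ→ℚ (V k j)
    }

  inverseRows-affine : ∀ {d} (U V : Matrix d) b → (∀ i j → (V ⊗ U) i j ≡ IdMatrix i j) →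
                       ∀ x k → ⟦ inverseRows V b k ⟧ (affine U b x) ≡ x k
  inverseRows-affine U V b V⊗U≡I x k = begin
    ⟦ inverseRows V b k ⟧ (affine U b x)
      ≡⟨ ⟦⟧-cong (inverseRows V b k) (affine≡⟦rows⟧ U b x) ⟩
    ⟦ inverseRows V b k ⟧ (λ j → ⟦ rows U b j ⟧ x)
      ≡˘⟨ ⟦∘ᵃ⟧ (inverseRows V b k) (rows U b) x ⟩
    ⟦ inverseRows V b k ∘ᵃ rows U b ⟧ x
      ≡⟨ ⟦⟧-cong-coeff _ record { const = 0ℚ ; coeff = e k } const≡0 coeff≡e x ⟩
    0ℚ + ∑ (λ p → e k p * x p)
      ≡⟨ ℚ.+-identityˡ _ ⟩
    ∑ (λ p → e k p * x p)
      ≡⟨ ∑-e* k x ⟩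
    x k
      ∎
    where
    const≡0 : - ∑ (λ j → ℤ→ℚ (V k j) * ℤ→ℚ (b j)) + ∑ (λ j → ℤ→ℚ (V k j) * ℤ→ℚ (b j)) ≡ 0ℚ
    const≡0 = ℚ.+-inverseˡ (∑ (λ j → ℤ→ℚ (V k j) * ℤ→ℚ (b j)))
    coeff≡e : ∀ p → ∑ (λ j → ℤ→ℚ (V k j) * ℤ→ℚ (U j p)) ≡ e k p
    coeff≡e p = trans (sym (ℤ→ℚ-homo-dot (V k) (λ j → U j p))) (cong ℤ→ℚ (V⊗U≡I k p))

module DoubleNegation where

  open import Data.Fin using (zero; suc)
  open import Effect.Monad using (RawMonad)
  open import Function using (_∘_)
  open import Relation.Nullary using (¬_)
  open import Relation.Nullary.Negation using (¬¬-Monad)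
  open import Level using (0ℓ)
  open RawMonad (¬¬-Monad {a = 0ℓ}) public using (pure; _>>=_; _<$>_)

  ¬¬-Π-Fin : ∀ {n} {B : Fin n → Set} → (∀ i → ¬ ¬ B i) → ¬ ¬ (∀ i → B i)
  ¬¬-Π-Fin {zero}  _   = pure (λ ())
  ¬¬-Π-Fin {suc n} ¬¬B = do
    b₀ ← ¬¬B zero
    bs ← ¬¬-Π-Fin (¬¬B ∘ suc)
    pure λ { zero → b₀ ; (suc i) → bs i }

module Inequalities where

  open import Data.Bool using (Bool; true; false; if_then_else_)
  open import Data.Product using (_×_; _,_)
  open import Data.Rational using (ℚ; 0ℚ; 1ℚ; _+_; _-_; _*_; -_; _≤_)
  import Data.Rational.Properties as ℚ
  open import Relation.Nullary using (¬_)
  open import Relation.Binary.PropositionalEquality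
  open ≡-Reasoning
  open Sums
  open IntegerPoints
  open AffineFunctions

  𝟙 : ∀ {d} → (Fin d → Bool) → Point d
  𝟙 D i = if D i then 1ℚ else 0ℚ

  0≤𝟙 : ∀ {d} (D : Fin d → Bool) i → 0ℚ ≤ 𝟙 D i
  0≤𝟙 D i with D i
  ... | true  = ℚ.nonNegative⁻¹ 1ℚ
  ... | false = ℚ.≤-refl

  𝟙≤1 : ∀ {d} (D : Fin d → Bool) i → 𝟙 D i ≤ 1ℚ
  𝟙≤1 D i with D i
  ... | true  = ℚ.≤-refl
  ... | false = ℚ.nonNegative⁻¹ 1ℚ

  data Ineq (d : ℕ) : Set where
    nonneg  : Fin d → Ineq d
    atMost1 : Fin d → Ineq d
    ordered : Fin d → Fin d → Ineq d

  slackAt : ∀ {d} → Ineq d → Point d → ℚ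
  slackAt (nonneg j)    y = y j
  slackAt (atMost1 i)   y = 1ℚ - y i
  slackAt (ordered i j) y = y i - y j

  slack : ∀ {d} → Ineq d → AffineFunction d
  slack (nonneg j)    = record { const = 0ℚ ; coeff = e j }
  slack (atMost1 i)   = record { const = 1ℚ ; coeff = λ p → - e i p }
  slack (ordered i j) = record { const = 0ℚ ; coeff = λ p → e i p - e j p }

  ∑-neg-e* : ∀ {d} (i : Fin d) (y : Point d) → ∑ (λ p → - e i p * y p) ≡ - y i
  ∑-neg-e* i y = begin
    ∑ (λ p → - e i p * y p)    ≡˘⟨ ∑-cong (λ p → ℚ.neg-distribˡ-* (e i p) (y p)) ⟩
    ∑ (λ p → - (e i p * y p))  ≡⟨ ∑-neg (λ p → e i p * y p) ⟩
    - ∑ (λ p → e i p * y p)    ≡⟨ cong -_ (∑-e* i y) ⟩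
    - y i                      ∎

  ⟦slack⟧ : ∀ {d} (t : Ineq d) y → ⟦ slack t ⟧ y ≡ slackAt t y
  ⟦slack⟧ (nonneg j)    y = trans (ℚ.+-identityˡ _) (∑-e* j y)
  ⟦slack⟧ (atMost1 i)   y = cong (_+_ 1ℚ) (∑-neg-e* i y)
  ⟦slack⟧ {d} (ordered i j) y = begin
    0ℚ + ∑ (λ p → (e i p - e j p) * y p)            ≡⟨ ℚ.+-identityˡ _ ⟩
    ∑ (λ p → (e i p - e j p) * y p)                 ≡⟨ ∑-cong (λ p → ℚ.*-distribʳ-+ (y p) (e i p) (- e j p)) ⟩
    ∑ (λ p → e i p * y p + - e j p * y p)           ≡⟨ ∑-distrib-+ {d} _ _ ⟩
    ∑ (λ p → e i p * y p) + ∑ (λ p → - e j p * y p) ≡⟨ cong₂ _+_ (∑-e* i y) (∑-neg-e* j y) ⟩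
    y i - y j                                       ∎

  Valid : ∀ {d} → (Fin d → Fin d → Set) → Ineq d → Set
  Valid _≺_ (nonneg j)    = ∀ s → ¬ j ≺ s
  Valid _≺_ (atMost1 i)   = ∀ r → ¬ r ≺ i
  Valid _≺_ (ordered i j) = i ≺ j

  Off : ∀ {d} → Ineq d → (Fin d → Bool) → Set
  Off (nonneg j)    D = D j ≡ true
  Off (atMost1 i)   D = D i ≡ false
  Off (ordered i j) D = D i ≡ true × D j ≡ false

  slackAt-off : ∀ {d} (t : Ineq d) D → Off t D → slackAt t (𝟙 D) ≡ 1ℚ
  slackAt-off (nonneg j)    D Dj≡true              rewrite Dj≡true = refl
  slackAt-off (atMost1 i)   D Di≡false             rewrite Di≡false = refl
  slackAt-off (ordered i j) D (Di≡true , Dj≡false) rewrite Di≡true | Dj≡false = refl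

module DownSets {d : ℕ} (Q : FinPoset d) (_≼?_ : Decidable (FinPoset._≼_ Q)) where

  open import Data.Fin using (zero; suc)
  open import Data.Fin.Properties using (_≟_; any?)
  open import Data.Bool using (Bool; true; false; _∨_; _∧_; not; if_then_else_)
  import Data.Bool.Properties as Bool
  open import Data.Integer as ℤ using (+_)
  open import Data.Rational using (0ℚ; 1ℚ; _+_; _≤_; *≤*)
  import Data.Rational.Properties as ℚ
  open import Data.Product using (∃; _×_; _,_; proj₁; proj₂)
  open import Data.Sum using (inj₁; inj₂)
  open import Data.Vec.Functional using (foldr)
  open import Function using (_∘_)
  open import Relation.Binary using (IsPartialOrder)
  open import Relation.Nullary using (¬_; yes; no; does; contradiction; ¬?; _×-dec_)
  open import Relation.Binary.PropositionalEquality
  open FinPoset Q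
  module ≼ = IsPartialOrder (FinPoset.isPartialOrder Q)
  open Sums using (nonneg-sum≡0ˡ; nonneg-sum≡0ʳ)
  open IntegerPoints
  open AffineFunctions
  open Inequalities
  open DoubleNegation

  _≺_ : Fin d → Fin d → Set
  i ≺ j = i ≼ j × i ≢ j

  _≺?_ : Decidable _≺_
  i ≺? j = (i ≼? j) ×-dec ¬? (i ≟ j)

  IsDownSet : (Fin d → Bool) → Set
  IsDownSet D = ∀ {i j} → i ≼ j → D j ≡ true → D i ≡ true

  𝟙∈orderPolytope : ∀ {D} → IsDownSet D → InOrderPolytope Q (𝟙 D)
  𝟙∈orderPolytope {D} D↓ = (λ i → 0≤𝟙 D i , 𝟙≤1 D i) , decreasing
    where
    decreasing : ∀ i j → i ≼ j → 𝟙 D j ≤ 𝟙 D i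
    decreasing i j i≼j with D j in Dj
    ... | true  rewrite D↓ i≼j Dj = ℚ.≤-refl
    ... | false = 0≤𝟙 D i

  integral⇒𝟙 : ∀ {y} (z : Fin d → ℤ) → (∀ k → y k ≡ ℤ→ℚ (z k)) → InOrderPolytope Q y →
               ∃ λ D → IsDownSet D × (∀ k → y k ≡ 𝟙 D k)
  integral⇒𝟙 {y} z y≡z (bounds , decreasing) = D , D↓ , y≡𝟙
    where
    D : Fin d → Bool
    D k = does (z k ℤ.≟ + 1)
    y≡𝟙 : ∀ k → y k ≡ 𝟙 D k
    y≡𝟙 k with ℤ→ℚ-∈[0,1] (z k) (subst (0ℚ ≤_) (y≡z k) (proj₁ (bounds k)))
                               (subst (_≤ 1ℚ) (y≡z k) (proj₂ (bounds k)))
    ... | inj₁ zk≡0 rewrite y≡z k | zk≡0 = refl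
    ... | inj₂ zk≡1 rewrite y≡z k | zk≡1 = refl
    D↓ : IsDownSet D
    D↓ {i} {j} i≼j Dj with D i in Di
    ... | true  = refl
    ... | false = contradiction (subst₂ _≤_ (trans (y≡𝟙 j) (cong (λ b → if b then 1ℚ else 0ℚ) Dj))
                                             (trans (y≡𝟙 i) (cong (λ b → if b then 1ℚ else 0ℚ) Di))
                                             (decreasing i j i≼j))
                                 λ { (*≤* (ℤ.+≤+ ())) }

  off-witness : ∀ t → Valid _≺_ t → ∃ λ D → IsDownSet D × Off t D
  off-witness (nonneg j)    _ = (λ _ → true) , (λ _ _ → refl) , refl
  off-witness (atMost1 i)   _ = (λ _ → false) , (λ _ ()) , refl
  off-witness (ordered i j) (i≼j , i≢j) = ↓i , ↓i-down , i∈↓i , j∉↓i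
    where
    ↓i : Fin d → Bool
    ↓i r = does (r ≼? i)
    ↓i-down : IsDownSet ↓i
    ↓i-down {r} {s} r≼s s∈↓i with s ≼? i | r ≼? i
    ... | yes _   | yes _   = refl
    ... | yes s≼i | no  r⋠i = contradiction (≼.trans r≼s s≼i) r⋠i
    i∈↓i : ↓i i ≡ true
    i∈↓i with i ≼? i
    ... | yes _   = refl
    ... | no  i⋠i = contradiction (≼.refl) i⋠i
    j∉↓i : ↓i j ≡ false
    j∉↓i with j ≼? i
    ... | yes j≼i = contradiction (≼.antisym i≼j j≼i) i≢j
    ... | no  _   = refl

  slackAt-on : ∀ {D} → IsDownSet D → ∀ t → Valid _≺_ t → ¬ Off t D → slackAt t (𝟙 D) ≡ 0ℚ
  slackAt-on {D} D↓ (nonneg j) _ ¬off with D j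
  ... | true  = contradiction refl ¬off
  ... | false = refl
  slackAt-on {D} D↓ (atMost1 i) _ ¬off with D i
  ... | true  = refl
  ... | false = contradiction refl ¬off
  slackAt-on {D} D↓ (ordered i j) (i≼j , _) ¬off with D j in Dj
  ... | true  rewrite D↓ i≼j Dj = refl
  ... | false with D i
  ...   | true  = contradiction (refl , refl) ¬off
  ...   | false = refl

  _∪_ _∩_ : (Fin d → Bool) → (Fin d → Bool) → (Fin d → Bool)
  (D ∪ E) i = D i ∨ E i
  (D ∩ E) i = D i ∧ E i

  ∪-down : ∀ {D E} → IsDownSet D → IsDownSet E → IsDownSet (D ∪ E)
  ∪-down {D} {E} D↓ E↓ {i} {j} i≼j j∈D∪E with D j in Dj
  ... | true  rewrite D↓ i≼j Dj = refl
  ... | false rewrite E↓ i≼j j∈D∪E = Bool.∨-zeroʳ (D i)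

  ∩-down : ∀ {D E} → IsDownSet D → IsDownSet E → IsDownSet (D ∩ E)
  ∩-down {D} {E} D↓ E↓ {i} {j} i≼j j∈D∩E with D j in Dj | E j in Ej
  ... | true | true rewrite D↓ i≼j Dj | E↓ i≼j Ej = refl

  𝟙-∪∩ : ∀ D E i → 𝟙 (D ∪ E) i + 𝟙 (D ∩ E) i ≡ 𝟙 D i + 𝟙 E i
  𝟙-∪∩ D E i with D i | E i
  ... | true  | true  = refl
  ... | true  | false = refl
  ... | false | true  = refl
  ... | false | false = refl

  ⋃-∌ : ∀ {n} (G : Fin n → Fin d → Bool) {J p} → (∀ r → G r p ≡ false) → J p ≡ false →
        foldr _∪_ J G p ≡ false
  ⋃-∌ {zero}  G _   p∉J = p∉J
  ⋃-∌ {suc n} G p∉G p∉J rewrite p∉G zero = ⋃-∌ (G ∘ suc) (p∉G ∘ suc) p∉J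

  ⋃-∋ : ∀ {n} (G : Fin n → Fin d → Bool) {J i} r → G r i ≡ true → foldr _∪_ J G i ≡ true
  ⋃-∋ G zero    i∈G rewrite i∈G = refl
  ⋃-∋ G {J} {i} (suc r) i∈G rewrite ⋃-∋ (G ∘ suc) {J} {i} r i∈G = Bool.∨-zeroʳ (G zero i)

  ⋂-∋ : ∀ {n} (G : Fin n → Fin d → Bool) {J p} → (∀ r → G r p ≡ true) → J p ≡ true →
        foldr _∩_ J G p ≡ true
  ⋂-∋ {zero}  G _   p∈J = p∈J
  ⋂-∋ {suc n} G p∈G p∈J rewrite p∈G zero = ⋂-∋ (G ∘ suc) (p∈G ∘ suc) p∈J

  ⋂-∌ : ∀ {n} (G : Fin n → Fin d → Bool) {J i} r → G r i ≡ false → foldr _∩_ J G i ≡ false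
  ⋂-∌ G zero    i∉G rewrite i∉G = refl
  ⋂-∌ G {J} {i} (suc r) i∉G rewrite ⋂-∌ (G ∘ suc) {J} {i} r i∉G = Bool.∧-zeroʳ (G zero i)

  insert delete : Fin d → (Fin d → Bool) → (Fin d → Bool)
  insert p D i = D i ∨ does (i ≟ p)
  delete p D i = D i ∧ not (does (i ≟ p))

  insert-down : ∀ {p W} → IsDownSet W → (∀ {r} → r ≺ p → W r ≡ true) → IsDownSet (insert p W)
  insert-down {p} {W} W↓ pred⊆W {i} {j} i≼j j∈W+p with i ≟ p | j ≟ p
  ... | yes _   | _      = Bool.∨-zeroʳ (W i)
  ... | no  i≢p | yes refl rewrite pred⊆W (i≼j , i≢p) = refl
  ... | no  _   | no  _  rewrite Bool.∨-identityʳ (W j) | Bool.∨-identityʳ (W i) = W↓ i≼j j∈W+p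

  delete-down : ∀ {p U} → IsDownSet U → (∀ {s} → p ≺ s → U s ≡ false) → IsDownSet (delete p U)
  delete-down {p} {U} U↓ succ∩U {i} {j} i≼j j∈U-p with i ≟ p | j ≟ p
  ... | _        | yes _ rewrite Bool.∧-zeroʳ (U j) = contradiction j∈U-p λ ()
  ... | yes refl | no j≢p =
    contradiction (trans (sym (succ∩U (i≼j , j≢p ∘ sym))) (trans (sym (Bool.∧-identityʳ (U j))) j∈U-p)) λ ()
  ... | no  _    | no _   rewrite Bool.∧-identityʳ (U j) | Bool.∧-identityʳ (U i) = U↓ i≼j j∈U-p

  𝟙-insert : ∀ {p D} → D p ≡ false → ∀ i → 𝟙 (insert p D) i ≡ 𝟙 D i + e p i
  𝟙-insert {p} {D} p∉D i with i ≟ p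
  ... | yes refl rewrite p∉D | e-diag p = refl
  ... | no  i≢p  rewrite Bool.∨-identityʳ (D i) | e-off (i≢p ∘ sym) = sym (ℚ.+-identityʳ (𝟙 D i))

  𝟙-delete : ∀ {p D} → D p ≡ true → ∀ i → 𝟙 D i ≡ 𝟙 (delete p D) i + e p i
  𝟙-delete {p} {D} p∈D i with i ≟ p
  ... | yes refl rewrite p∈D | e-diag p = refl
  ... | no  i≢p  rewrite Bool.∧-identityʳ (D i) | e-off (i≢p ∘ sym) = sym (ℚ.+-identityʳ (𝟙 D i))

  module Lattice (h : AffineFunction d) (h≥0 : ∀ {D} → IsDownSet D → 0ℚ ≤ ⟦ h ⟧ (𝟙 D)) where

    IsZero : (Fin d → Bool) → Set
    IsZero D = IsDownSet D × ⟦ h ⟧ (𝟙 D) ≡ 0ℚ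

    FaceIn : Ineq d → Set
    FaceIn t = ∀ D → IsZero D → ¬ Off t D

    ⟦h⟧-∪∩ : ∀ D E → ⟦ h ⟧ (𝟙 (D ∪ E)) + ⟦ h ⟧ (𝟙 (D ∩ E)) ≡ ⟦ h ⟧ (𝟙 D) + ⟦ h ⟧ (𝟙 E)
    ⟦h⟧-∪∩ D E = begin
      ⟦ h ⟧ (𝟙 (D ∪ E)) + ⟦ h ⟧ (𝟙 (D ∩ E))                ≡˘⟨ ⟦⟧-+ h (𝟙 (D ∪ E)) (𝟙 (D ∩ E)) ⟩
      ⟦ h ⟧ (λ i → 𝟙 (D ∪ E) i + 𝟙 (D ∩ E) i) + const h  ≡⟨ cong (_+ const h) (⟦⟧-cong h (𝟙-∪∩ D E)) ⟩
      ⟦ h ⟧ (λ i → 𝟙 D i + 𝟙 E i) + const h              ≡⟨ ⟦⟧-+ h (𝟙 D) (𝟙 E) ⟩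
      ⟦ h ⟧ (𝟙 D) + ⟦ h ⟧ (𝟙 E)                          ∎
      where open ≡-Reasoning

    ∪∩-zero : ∀ {D E} → IsZero D → IsZero E → IsZero (D ∪ E) × IsZero (D ∩ E)
    ∪∩-zero {D} {E} (D↓ , hD≡0) (E↓ , hE≡0) =
      (D∪E↓ , nonneg-sum≡0ˡ (h≥0 D∪E↓) (h≥0 D∩E↓) sum≡0) ,
      (D∩E↓ , nonneg-sum≡0ʳ (h≥0 D∪E↓) (h≥0 D∩E↓) sum≡0)
      where
      D∪E↓ = ∪-down D↓ E↓
      D∩E↓ = ∩-down D↓ E↓
      sum≡0 : ⟦ h ⟧ (𝟙 (D ∪ E)) + ⟦ h ⟧ (𝟙 (D ∩ E)) ≡ 0ℚ
      sum≡0 = trans (⟦h⟧-∪∩ D E) (cong₂ _+_ hD≡0 hE≡0)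

    ⋃-zero : ∀ {n} (G : Fin n → Fin d → Bool) {J} → (∀ r → IsZero (G r)) → IsZero J → IsZero (foldr _∪_ J G)
    ⋃-zero {zero}  G zG zJ = zJ
    ⋃-zero {suc n} G zG zJ = proj₁ (∪∩-zero (zG zero) (⋃-zero (G ∘ suc) (zG ∘ suc) zJ))

    ⋂-zero : ∀ {n} (G : Fin n → Fin d → Bool) {J} → (∀ r → IsZero (G r)) → IsZero J → IsZero (foldr _∩_ J G)
    ⋂-zero {zero}  G zG zJ = zJ
    ⋂-zero {suc n} G zG zJ = proj₂ (∪∩-zero (zG zero) (⋂-zero (G ∘ suc) (zG ∘ suc) zJ))

    module _ (¬faceIn : ∀ t → Valid _≺_ t → ¬ FaceIn t) where

      zero-off : ∀ t → Valid _≺_ t → ¬ ¬ ∃ λ D → IsZero D × Off t D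
      zero-off t valid ∄ = ¬faceIn t valid (λ D zD off → ∄ (D , zD , off))

      zero-∌ : ∀ p → ¬ ¬ ∃ λ J → IsZero J × J p ≡ false
      zero-∌ p with any? (_≺? p)
      ... | yes (r , r≺p) = (λ (J , zJ , _ , p∉J) → J , zJ , p∉J) <$> zero-off (ordered r p) r≺p
      ... | no  ∄r        = zero-off (atMost1 p) (λ r r≺p → ∄r (r , r≺p))

      zero-∋ : ∀ p → ¬ ¬ ∃ λ J → IsZero J × J p ≡ true
      zero-∋ p with any? (p ≺?_)
      ... | yes (s , p≺s) = (λ (J , zJ , p∈J , _) → J , zJ , p∈J) <$> zero-off (ordered p s) p≺s
      ... | no  ∄s        = zero-off (nonneg p) (λ s p≺s → ∄s (s , p≺s))

      zero-⊇-predecessors : ∀ p → ¬ ¬ ∃ λ W → IsZero W × W p ≡ false × (∀ {r} → r ≺ p → W r ≡ true)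
      zero-⊇-predecessors p = do
        (J , zJ , p∉J) ← zero-∌ p
        Ds ← ¬¬-Π-Fin (separating J zJ p∉J)
        pure ( foldr _∪_ J (proj₁ ∘ Ds)
             , ⋃-zero (proj₁ ∘ Ds) (proj₁ ∘ proj₂ ∘ Ds) zJ
             , ⋃-∌ (proj₁ ∘ Ds) (proj₁ ∘ proj₂ ∘ proj₂ ∘ Ds) p∉J
             , λ {r} r≺p → ⋃-∋ (proj₁ ∘ Ds) r (proj₂ (proj₂ (proj₂ (Ds r))) r≺p) )
        where
        separating : ∀ J → IsZero J → J p ≡ false → ∀ r →
                     ¬ ¬ ∃ λ D → IsZero D × D p ≡ false × (r ≺ p → D r ≡ true)
        separating J zJ p∉J r with r ≺? p
        ... | yes r≺p = (λ (D , zD , r∈D , p∉D) → D , zD , p∉D , λ _ → r∈D) <$> zero-off (ordered r p) r≺p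
        ... | no  r⊀p = pure (J , zJ , p∉J , λ r≺p → contradiction r≺p r⊀p)

      zero-∌-successors : ∀ p → ¬ ¬ ∃ λ U → IsZero U × U p ≡ true × (∀ {s} → p ≺ s → U s ≡ false)
      zero-∌-successors p = do
        (J , zJ , p∈J) ← zero-∋ p
        Ds ← ¬¬-Π-Fin (separating J zJ p∈J)
        pure ( foldr _∩_ J (proj₁ ∘ Ds)
             , ⋂-zero (proj₁ ∘ Ds) (proj₁ ∘ proj₂ ∘ Ds) zJ
             , ⋂-∋ (proj₁ ∘ Ds) (proj₁ ∘ proj₂ ∘ proj₂ ∘ Ds) p∈J
             , λ {s} p≺s → ⋂-∌ (proj₁ ∘ Ds) s (proj₂ (proj₂ (proj₂ (Ds s))) p≺s) )
        where
        separating : ∀ J → IsZero J → J p ≡ true → ∀ s →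
                     ¬ ¬ ∃ λ D → IsZero D × D p ≡ true × (p ≺ s → D s ≡ false)
        separating J zJ p∈J s with p ≺? s
        ... | yes p≺s = (λ (D , zD , p∈D , s∉D) → D , zD , p∈D , λ _ → s∉D) <$> zero-off (ordered p s) p≺s
        ... | no  p⊀s = pure (J , zJ , p∈J , λ p≺s → contradiction p≺s p⊀s)

      -- W ∪ {p} and U ∖ {p} are down-sets, on which h takes the values coeff h p and − coeff h p.
      coeff≡0 : ∀ p → ¬ ¬ coeff h p ≡ 0ℚ
      coeff≡0 p = do
        (W , (W↓ , hW≡0) , p∉W , pred⊆W) ← zero-⊇-predecessors p
        (U , (U↓ , hU≡0) , p∈U , succ∩U≡∅) ← zero-∌-successors p
        let W+p↓ = insert-down W↓ pred⊆W
            U-p↓ = delete-down U↓ succ∩U≡∅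
            h[W+p]≡coeff : ⟦ h ⟧ (𝟙 (insert p W)) ≡ coeff h p
            h[W+p]≡coeff = begin
              ⟦ h ⟧ (𝟙 (insert p W))             ≡⟨ ⟦⟧-cong h (𝟙-insert p∉W) ⟩
              ⟦ h ⟧ (λ i → 𝟙 W i + e p i)        ≡⟨ ⟦⟧-+e h (𝟙 W) p ⟩
              ⟦ h ⟧ (𝟙 W) + coeff h p            ≡⟨ cong (_+ coeff h p) hW≡0 ⟩
              0ℚ + coeff h p                     ≡⟨ ℚ.+-identityˡ (coeff h p) ⟩
              coeff h p                          ∎
            h[U-p]+coeff≡0 : ⟦ h ⟧ (𝟙 (delete p U)) + coeff h p ≡ 0ℚ
            h[U-p]+coeff≡0 = begin
              ⟦ h ⟧ (𝟙 (delete p U)) + coeff h p        ≡˘⟨ ⟦⟧-+e h (𝟙 (delete p U)) p ⟩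
              ⟦ h ⟧ (λ i → 𝟙 (delete p U) i + e p i)   ≡˘⟨ ⟦⟧-cong h (𝟙-delete p∈U) ⟩
              ⟦ h ⟧ (𝟙 U)                              ≡⟨ hU≡0 ⟩
              0ℚ                                       ∎
        pure (nonneg-sum≡0ʳ (h≥0 U-p↓) (subst (0ℚ ≤_) h[W+p]≡coeff (h≥0 W+p↓)) h[U-p]+coeff≡0)
        where open ≡-Reasoning

      vanishing : Fin d → ¬ ¬ (∀ D → ⟦ h ⟧ (𝟙 D) ≡ 0ℚ)
      vanishing p = do
        coeffs≡0 ← ¬¬-Π-Fin coeff≡0
        (J , (_ , hJ≡0) , _) ← zero-∌ p
        pure λ D → trans (⟦⟧-constant h coeffs≡0 (𝟙 D))
                         (trans (sym (⟦⟧-constant h coeffs≡0 (𝟙 J))) hJ≡0)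

    face-in-hyperplane : Fin d → ∀ {D} → ⟦ h ⟧ (𝟙 D) ≢ 0ℚ → ¬ ¬ ∃ λ t → Valid _≺_ t × FaceIn t
    face-in-hyperplane p {D} hD≢0 ∄ =
      vanishing (λ t valid faceIn → ∄ (t , valid , faceIn)) p (λ h≡0 → hD≢0 (h≡0 D))

module Counting where

  open import Data.Nat using (_+_; _*_; _≤_)
  open import Data.Nat.Properties using (+-suc)
  open import Data.Fin.Properties using (_≟_; any?; injective⇒≤)
  open import Data.Bool using (Bool; true; false)
  import Data.Bool.Properties as Bool
  open import Data.List using (List; []; _∷_; map; filter; length; lookup; cartesianProduct; allFin)
  open import Data.List.Properties using (length-++; length-map; length-tabulate)
  open import Data.List.Membership.Propositional using (_∈_)
  open import Data.List.Membership.Propositional.Properties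
    using (∈-map⁺; ∈-filter⁺; ∈-allFin; ∈-cartesianProduct⁺)
  open import Data.List.Relation.Unary.Any using (here; there; index)
  open import Data.List.Relation.Unary.Any.Properties using (lookup-index)
  open import Data.Maybe using (Maybe; just; nothing)
  open import Data.Product using (∃₂; _×_; _,_)
  open import Data.Sum using (_⊎_; inj₁; inj₂)
  open import Function using (_∘_; id)
  open import Function.Definitions using (Injective)
  open import Relation.Nullary using (yes; no; contradiction)
  open import Relation.Binary.PropositionalEquality
  open Inequalities

  injective⇒≤length : ∀ {A : Set} {N} (L : List A) (f : Fin N → A) →
                      Injective _≡_ _≡_ f → (∀ s → f s ∈ L) → N ≤ length L
  injective⇒≤length L f f-inj f∈L = injective⇒≤ {f = index ∘ f∈L} λ {s} {s′} eq →
    f-inj (trans (lookup-index (f∈L s)) (trans (cong (lookup L) eq) (sym (lookup-index (f∈L s′)))))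

  length-cartesianProduct : ∀ {A B : Set} (xs : List A) (ys : List B) →
                            length (cartesianProduct xs ys) ≡ length xs * length ys
  length-cartesianProduct []       ys = refl
  length-cartesianProduct (x ∷ xs) ys =
    trans (length-++ (map (x ,_) ys)) (cong₂ _+_ (length-map (x ,_) ys) (length-cartesianProduct xs ys))

  length-filter-true+false : ∀ {A : Set} (B : A → Bool) xs →
    length (filter (λ x → B x Bool.≟ true) xs) + length (filter (λ x → B x Bool.≟ false) xs) ≡ length xs
  length-filter-true+false B []       = refl
  length-filter-true+false B (x ∷ xs) with B x
  ... | true  = cong suc (length-filter-true+false B xs)
  ... | false = trans (+-suc _ _) (cong suc (length-filter-true+false B xs))

  module _ {n} (_≺_ : Fin n → Fin n → Set) (B : Fin n → Bool) where

    Good : Ineq n → Set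
    Good t = Valid _≺_ t × Off t B

    position : Ineq n → Fin n
    position (nonneg j)    = j
    position (atMost1 i)   = i
    position (ordered i j) = i

    position-injective : ∀ {N} (T : Fin N → Ineq n) → Injective _≡_ _≡_ T →
                         ∀ (c : Fin n → Ineq n) → (∀ s → T s ≡ c (position (T s))) →
                         Injective _≡_ _≡_ (position ∘ T)
    position-injective T T-inj c T≡c {s} {s′} eq = T-inj (trans (T≡c s) (trans (cong c eq) (sym (T≡c s′))))

    module Coding {i* j*} (i*∈B : B i* ≡ true) (j*∉B : B j* ≡ false) where

      inside  = filter (λ i → B i Bool.≟ true) (allFin n)
      outside = filter (λ i → B i Bool.≟ false) (allFin n)

      codes : List (Maybe (Fin n × Fin n))
      codes = nothing ∷ map just (cartesianProduct inside outside)

      length-codes : length codes ≡ suc (length inside * length outside)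
      length-codes = cong suc (trans (length-map just (cartesianProduct inside outside))
                                     (length-cartesianProduct inside outside))

      pair∈codes : ∀ {i j} → B i ≡ true → B j ≡ false → just (i , j) ∈ codes
      pair∈codes i∈B j∉B =
        there (∈-map⁺ just (∈-cartesianProduct⁺ (∈-filter⁺ _ (∈-allFin _) i∈B) (∈-filter⁺ _ (∈-allFin _) j∉B)))

      -- The plain codes (j , j*), (i* , i), (i , j) of nonneg j, atMost1 i, ordered i j collide
      -- only for nonneg i* and atMost1 j* (the collisions with ordered contradict Valid).
      codeMin : Fin n → Maybe (Fin n × Fin n)
      codeMin i with i ≟ j*
      ... | yes _ = nothing
      ... | no  _ = just (i* , i)

      code : Ineq n → Maybe (Fin n × Fin n)
      code (nonneg j)    = just (j , j*)
      code (atMost1 i)   = codeMin i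
      code (ordered i j) = just (i , j)

      code∈codes : ∀ {t} → Good t → code t ∈ codes
      code∈codes {nonneg j}    (_ , j∈B)         = pair∈codes j∈B j*∉B
      code∈codes {atMost1 i}   (_ , i∉B)         with i ≟ j*
      ... | yes _ = here refl
      ... | no  _ = pair∈codes i*∈B i∉B
      code∈codes {ordered i j} (_ , i∈B , j∉B)   = pair∈codes i∈B j∉B

      codeMin-just : ∀ {i p} → codeMin i ≡ just p → p ≡ (i* , i) × i ≢ j*
      codeMin-just {i} eq with i ≟ j*
      codeMin-just refl | no i≢j* = refl , i≢j*

      codeMin-injective : ∀ {i i′} → codeMin i ≡ codeMin i′ → i ≡ i′
      codeMin-injective {i} {i′} eq with i ≟ j* | i′ ≟ j*
      ... | yes i≡j* | yes i′≡j* = trans i≡j* (sym i′≡j*)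
      codeMin-injective refl | no _ | no _ = refl

      code-injective : ∀ {t t′} → Good t → Good t′ → code t ≡ code t′ → t ≡ t′
      code-injective {nonneg j}    {nonneg _}    _ _ refl = refl
      code-injective {nonneg j}    {atMost1 i}   _ _ eq
        with codeMin-just (sym eq)
      ... | refl , i≢j* = contradiction refl i≢j*
      code-injective {nonneg j}    {ordered _ _} (j-max , _) (j≺j* , _) refl = contradiction j≺j* (j-max j*)
      code-injective {atMost1 i}   {nonneg j}    _ _ eq
        with codeMin-just eq
      ... | refl , i≢j* = contradiction refl i≢j*
      code-injective {atMost1 i}   {atMost1 i′}  _ _ eq = cong atMost1 (codeMin-injective eq)
      code-injective {atMost1 i}   {ordered _ _} (i-min , _) (i*≺i , _) eq
        with codeMin-just eq
      ... | refl , _ = contradiction i*≺i (i-min i*)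
      code-injective {ordered i j} {nonneg _}    (i≺j* , _) (i-max , _) refl = contradiction i≺j* (i-max j*)
      code-injective {ordered i j} {atMost1 i′}  (i*≺i′ , _) (i′-min , _) eq
        with codeMin-just (sym eq)
      ... | refl , _ = contradiction i*≺i′ (i′-min i*)
      code-injective {ordered i j} {ordered _ _} _ _ refl = refl

    good-count : ∀ {N} (T : Fin N → Ineq n) → Injective _≡_ _≡_ T → (∀ s → Good (T s)) →
                 N ≤ n ⊎ ∃₂ λ k l → k + l ≡ n × N ≤ suc (k * l)
    good-count {N} T T-inj good with any? (λ i → B i Bool.≟ true) | any? (λ j → B j Bool.≟ false)
    ... | yes (i* , i*∈B) | yes (j* , j*∉B) =
      inj₂ (length inside , length outside , trans (length-filter-true+false B (allFin n)) (length-tabulate id) ,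
            subst (N ≤_) length-codes
              (injective⇒≤length codes (code ∘ T)
                (λ eq → T-inj (code-injective (good _) (good _) eq)) (code∈codes ∘ good)))
      where open Coding i*∈B j*∉B
    ... | no ∄∈B | _ = inj₁ (injective⇒≤ (position-injective T T-inj atMost1 (only-atMost1 ∘ good)))
      where
      only-atMost1 : ∀ {t} → Good t → t ≡ atMost1 (position t)
      only-atMost1 {nonneg j}    (_ , j∈B)     = contradiction (j , j∈B) ∄∈B
      only-atMost1 {atMost1 i}   _             = refl
      only-atMost1 {ordered i j} (_ , i∈B , _) = contradiction (i , i∈B) ∄∈B
    ... | _ | no ∄∉B = inj₁ (injective⇒≤ (position-injective T T-inj nonneg (only-nonneg ∘ good)))
      where
      only-nonneg : ∀ {t} → Good t → t ≡ nonneg (position t)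
      only-nonneg {nonneg j}    _             = refl
      only-nonneg {atMost1 i}   (_ , i∉B)     = contradiction (i , i∉B) ∄∉B
      only-nonneg {ordered i j} (_ , _ , j∉B) = contradiction (j , j∉B) ∄∉B

module ChainPolytopes {d : ℕ} (P : FinPoset d) where

  open import Data.Bool using (Bool; true; false; if_then_else_)
  open import Data.Rational using (0ℚ; 1ℚ; _+_; _-_; _*_; -_; _≤_)
  import Data.Rational.Properties as ℚ
  open import Data.Product using (_,_; proj₁)
  open import Relation.Nullary using (¬_; contradiction)
  open import Relation.Binary.PropositionalEquality
  open Sums
  open IntegerPoints
  open AffineFunctions
  open Inequalities

  chainSum chainSlack : (Fin d → Bool) → AffineFunction d
  chainSum   C = record { const = 0ℚ ; coeff = 𝟙 C }
  chainSlack C = record { const = 1ℚ ; coeff = λ i → - 𝟙 C i }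

  sel≡𝟙* : ∀ b q → sel b q ≡ (if b then 1ℚ else 0ℚ) * q
  sel≡𝟙* true  q = sym (ℚ.*-identityˡ q)
  sel≡𝟙* false q = sym (ℚ.*-zeroˡ q)

  ∑sel≡⟦chainSum⟧ : ∀ C x → ∑ (λ i → sel (C i) (x i)) ≡ ⟦ chainSum C ⟧ x
  ∑sel≡⟦chainSum⟧ C x = trans (∑-cong (λ i → sel≡𝟙* (C i) (x i))) (sym (ℚ.+-identityˡ _))

  ⟦chainSlack⟧ : ∀ C x → ⟦ chainSlack C ⟧ x ≡ 1ℚ - ∑ (λ i → sel (C i) (x i))
  ⟦chainSlack⟧ C x = cong (_+_ 1ℚ) (begin
    ∑ (λ i → - 𝟙 C i * x i)    ≡˘⟨ ∑-cong (λ i → ℚ.neg-distribˡ-* (𝟙 C i) (x i)) ⟩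
    ∑ (λ i → - (𝟙 C i * x i))  ≡⟨ ∑-neg (λ i → 𝟙 C i * x i) ⟩
    - ∑ (λ i → 𝟙 C i * x i)    ≡˘⟨ cong -_ (∑-cong (λ i → sel≡𝟙* (C i) (x i))) ⟩
    - ∑ (λ i → sel (C i) (x i)) ∎)
    where open ≡-Reasoning

  chainSlack≥0 : ∀ {C x} → IsMaximalChain P C → InChainPolytope P x → 0ℚ ≤ ⟦ chainSlack C ⟧ x
  chainSlack≥0 {C} {x} C-max (_ , chain-sum≤1) = begin
    0ℚ                                      ≡˘⟨ ℚ.+-inverseʳ s ⟩
    s - s                                   ≤⟨ ℚ.+-monoˡ-≤ (- s) (chain-sum≤1 C C-max) ⟩
    1ℚ - s                                  ≡˘⟨ ⟦chainSlack⟧ C x ⟩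
    ⟦ chainSlack C ⟧ x                      ∎
    where
    open ℚ.≤-Reasoning
    s = ∑ (λ i → sel (C i) (x i))

  0∈chainPolytope : InChainPolytope P (λ _ → 0ℚ)
  0∈chainPolytope = (λ _ → ℚ.≤-refl) , λ C _ → ℚ.≤-trans
    (ℚ.≤-reflexive (trans (∑sel≡⟦chainSum⟧ C _) (⟦⟧-zero (chainSum C)))) (ℚ.nonNegative⁻¹ 1ℚ)

  e∈chainPolytope : ∀ c → InChainPolytope P (e c)
  e∈chainPolytope c = 0≤e c , λ C _ → ℚ.≤-trans
    (ℚ.≤-reflexive (trans (∑sel≡⟦chainSum⟧ C (e c)) (⟦⟧-e (chainSum C) c)))
    (subst (_≤ 1ℚ) (sym (ℚ.+-identityˡ (𝟙 C c))) (𝟙≤1 C c))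

  e+e∈chainPolytope : ∀ {c p} → ¬ Comparable P c p → InChainPolytope P (λ i → e c i + e p i)
  e+e∈chainPolytope {c} {p} c∥p = (λ i → ℚ.+-mono-≤ (0≤e c i) (0≤e p i)) , λ C C-max → ℚ.≤-trans
    (ℚ.≤-reflexive (trans (∑sel≡⟦chainSum⟧ C _) (⟦⟧-e+e (chainSum C) c p)))
    (at-most-one C (proj₁ C-max))
    where
    at-most-one : ∀ C → IsChain P C → (0ℚ + 𝟙 C c) + 𝟙 C p ≤ 1ℚ
    at-most-one C C-chain with C c in Cc | C p in Cp
    ... | true  | true  = contradiction (C-chain c p Cc Cp) c∥p
    ... | true  | false = ℚ.≤-refl
    ... | false | true  = ℚ.≤-refl
    ... | false | false = ℚ.nonNegative⁻¹ 1ℚ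

module LevelPosets {d r : ℕ} (level : Fin d → Fin r) where

  open import Data.Fin using (_<_)
  open import Data.Fin.Properties using (_≟_; <-trans; <-irrefl; <-asym; <-cmp)
  open import Data.Bool using (Bool; true; false)
  open import Data.Product using (_,_)
  open import Data.Sum using (_⊎_; inj₁; inj₂)
  open import Relation.Binary using (tri<; tri≈; tri>)
  open import Relation.Nullary using (¬_; yes; no; does; contradiction)
  open import Relation.Binary.PropositionalEquality

  _≼_ : Fin d → Fin d → Set
  i ≼ j = i ≡ j ⊎ level i < level j

  ≼-trans : ∀ {i j k} → i ≼ j → j ≼ k → i ≼ k
  ≼-trans (inj₁ refl) j≼k         = j≼k
  ≼-trans (inj₂ i<j)  (inj₁ refl) = inj₂ i<j
  ≼-trans (inj₂ i<j)  (inj₂ j<k)  = inj₂ (<-trans i<j j<k)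

  ≼-antisym : ∀ {i j} → i ≼ j → j ≼ i → i ≡ j
  ≼-antisym (inj₁ i≡j) _           = i≡j
  ≼-antisym (inj₂ _)   (inj₁ j≡i)  = sym j≡i
  ≼-antisym (inj₂ i<j) (inj₂ j<i)  = contradiction j<i (<-asym i<j)

  levelPoset : FinPoset d
  levelPoset = record
    { _≼_            = _≼_
    ; isPartialOrder = record
      { isPreorder = record { isEquivalence = isEquivalence ; reflexive = inj₁ ; trans = ≼-trans }
      ; antisym    = ≼-antisym
      }
    }

  same-level⇒incomparable : ∀ {i j} → level i ≡ level j → i ≢ j → ¬ Comparable levelPoset i j
  same-level⇒incomparable _  i≢j (inj₁ (inj₁ i≡j)) = i≢j i≡j
  same-level⇒incomparable li≡lj _ (inj₁ (inj₂ li<lj)) = <-irrefl li≡lj li<lj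
  same-level⇒incomparable _  i≢j (inj₂ (inj₁ j≡i)) = i≢j (sym j≡i)
  same-level⇒incomparable li≡lj _ (inj₂ (inj₂ lj<li)) = <-irrefl (sym li≡lj) lj<li

  module Section (σ : Fin r → Fin d) (σ-section : ∀ ℓ → level (σ ℓ) ≡ ℓ) where

    chain : Fin d → Bool
    chain i = does (σ (level i) ≟ i)

    ∈chain⇒ : ∀ {i} → chain i ≡ true → σ (level i) ≡ i
    ∈chain⇒ {i} i∈chain with σ (level i) ≟ i
    ... | yes σ[li]≡i = σ[li]≡i

    ∉chain⇒ : ∀ {i} → chain i ≡ false → σ (level i) ≢ i
    ∉chain⇒ {i} i∉chain with σ (level i) ≟ i
    ... | no σ[li]≢i = σ[li]≢i

    ≢⇒∉chain : ∀ {i} → σ (level i) ≢ i → chain i ≡ false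
    ≢⇒∉chain {i} σ[li]≢i with σ (level i) ≟ i
    ... | yes σ[li]≡i = contradiction σ[li]≡i σ[li]≢i
    ... | no  _       = refl

    σ∈chain : ∀ ℓ → chain (σ ℓ) ≡ true
    σ∈chain ℓ with σ (level (σ ℓ)) ≟ σ ℓ
    ... | yes _         = refl
    ... | no  σ[lσℓ]≢σℓ = contradiction (cong σ (σ-section ℓ)) σ[lσℓ]≢σℓ

    chain-maximal : IsMaximalChain levelPoset chain
    chain-maximal = is-chain , maximal
      where
      is-chain : IsChain levelPoset chain
      is-chain i j i∈chain j∈chain with <-cmp (level i) (level j)
      ... | tri< li<lj _ _ = inj₁ (inj₂ li<lj)
      ... | tri> _ _ lj<li = inj₂ (inj₂ lj<li)
      ... | tri≈ _ li≡lj _ = inj₁ (inj₁ (trans (sym (∈chain⇒ i∈chain)) (trans (cong σ li≡lj) (∈chain⇒ j∈chain))))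
      maximal : ∀ j → (∀ i → chain i ≡ true → Comparable levelPoset i j) → chain j ≡ true
      maximal j comparable with comparable (σ (level j)) (σ∈chain (level j))
      ... | inj₁ (inj₁ σ[lj]≡j) = subst (λ k → chain k ≡ true) σ[lj]≡j (σ∈chain (level j))
      ... | inj₁ (inj₂ l<lj)    = contradiction l<lj (<-irrefl (σ-section (level j)))
      ... | inj₂ (inj₁ j≡σ[lj]) = subst (λ k → chain k ≡ true) (sym j≡σ[lj]) (σ∈chain (level j))
      ... | inj₂ (inj₂ lj<l)    = contradiction lj<l (<-irrefl (sym (σ-section (level j))))

module Obstruction
  {d r : ℕ} (level : Fin d → Fin (suc r))
  (Q : FinPoset d) (_≼?_ : Decidable (FinPoset._≼_ Q))
  (U V : Matrix d) (b : Fin d → ℤ) (V⊗U≡I : ∀ i j → (V ⊗ U) i j ≡ IdMatrix i j)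
  (f-onto : MapsOnto (affine U b) (InChainPolytope (LevelPosets.levelPoset level)) (InOrderPolytope Q))
  where

  import Data.Nat as ℕ
  import Data.Nat.Properties as ℕ
  open import Data.Fin using (zero)
  open import Data.Fin.Properties using (_≟_)
  open import Data.Bool using (Bool; true; false; if_then_else_)
  open import Data.Integer as ℤ using (+_)
  open import Data.Rational using (0ℚ; 1ℚ; _+_; -_; _≤_)
  import Data.Rational.Properties as ℚ
  open import Data.Product using (∃; ∃₂; _×_; _,_; proj₁; proj₂)
  open import Data.Sum using (_⊎_; inj₁; inj₂)
  open import Data.Empty using (⊥; ⊥-elim)
  open import Function using (_∘_)
  open import Function.Definitions using (Injective)
  open import Relation.Nullary using (¬_; yes; no; contradiction)
  open import Relation.Binary.PropositionalEquality
  open IntegerPoints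
  open AffineFunctions
  open Inequalities
  open DoubleNegation
  open LevelPosets level
  open ChainPolytopes levelPoset
  open DownSets Q _≼?_
  open Counting

  f : Point d → Point d
  f = affine U b

  f-integral : ∀ x (z : Fin d → ℤ) → (∀ i → x i ≡ ℤ→ℚ (z i)) → InChainPolytope levelPoset x →
               ∃ λ D → IsDownSet D × (∀ k → f x k ≡ 𝟙 D k)
  f-integral x z x≡z x∈𝒞 =
    integral⇒𝟙 (λ k → ∑ℤ (λ j → U k j ℤ.* z j) ℤ.+ b k) (affine-integral U b z x≡z) (proj₁ f-onto x x∈𝒞)

  base : ∃ λ B → IsDownSet B × (∀ k → f (λ _ → 0ℚ) k ≡ 𝟙 B k)
  base = f-integral (λ _ → 0ℚ) (λ _ → + 0) (λ _ → refl) 0∈chainPolytope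

  B : Fin d → Bool
  B = proj₁ base

  slackAt-cong : ∀ (t : Ineq d) {x y} → (∀ i → x i ≡ y i) → slackAt t x ≡ slackAt t y
  slackAt-cong t {x} {y} x≡y = trans (sym (⟦slack⟧ t x)) (trans (⟦⟧-cong (slack t) x≡y) (⟦slack⟧ t y))

  G : Ineq d → AffineFunction d
  G t = slack t ∘ᵃ rows U b

  ⟦G⟧ : ∀ (t : Ineq d) x → ⟦ G t ⟧ x ≡ slackAt t (f x)
  ⟦G⟧ t x = trans (⟦∘ᵃ⟧ (slack t) (rows U b) x)
                  (trans (sym (⟦⟧-cong (slack t) (affine≡⟦rows⟧ U b x))) (⟦slack⟧ t (f x)))

  const-G : ∀ (t : Ineq d) → const (G t) ≡ slackAt t (𝟙 B)
  const-G t = trans (sym (⟦⟧-zero (G t))) (trans (⟦G⟧ t _) (slackAt-cong t (proj₂ (proj₂ base))))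

  G≢0 : ∀ {t} → Valid _≺_ t → const (G t) ≡ 0ℚ → ¬ (∀ p → coeff (G t) p ≡ 0ℚ)
  G≢0 {t} valid const≡0 coeff≡0 with off-witness t valid
  ... | D , D↓ , off with proj₂ f-onto (𝟙 D) (𝟙∈orderPolytope D↓)
  ...   | x , _ , fx≡𝟙D = contradiction 1≡0 λ ()
    where
    1≡0 : 1ℚ ≡ 0ℚ
    1≡0 = begin
      1ℚ                   ≡˘⟨ slackAt-off t D off ⟩
      slackAt t (𝟙 D)      ≡˘⟨ slackAt-cong t fx≡𝟙D ⟩
      slackAt t (f x)      ≡˘⟨ ⟦G⟧ t x ⟩
      ⟦ G t ⟧ x            ≡⟨ ⟦⟧-constant (G t) coeff≡0 x ⟩
      const (G t)          ≡⟨ const≡0 ⟩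
      0ℚ                   ∎
      where open ≡-Reasoning

  module AtSection (σ : Fin (suc r) → Fin d) (σ-section : ∀ ℓ → level (σ ℓ) ≡ ℓ) where

    open Section σ σ-section

    H : AffineFunction d
    H = chainSlack chain ∘ᵃ inverseRows V b

    H∘f : ∀ x → ⟦ H ⟧ (f x) ≡ ⟦ chainSlack chain ⟧ x
    H∘f x = trans (⟦∘ᵃ⟧ (chainSlack chain) (inverseRows V b) (f x))
                  (⟦⟧-cong (chainSlack chain) (inverseRows-affine U V b V⊗U≡I x))

    H≥0 : ∀ {D} → IsDownSet D → 0ℚ ≤ ⟦ H ⟧ (𝟙 D)
    H≥0 {D} D↓ with proj₂ f-onto (𝟙 D) (𝟙∈orderPolytope D↓)
    ... | x , x∈𝒞 , fx≡𝟙D =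
      subst (0ℚ ≤_) (trans (sym (H∘f x)) (⟦⟧-cong H fx≡𝟙D)) (chainSlack≥0 chain-maximal x∈𝒞)

    H[𝟙B]≡1 : ⟦ H ⟧ (𝟙 B) ≡ 1ℚ
    H[𝟙B]≡1 = trans (sym (⟦⟧-cong H (proj₂ (proj₂ base)))) (trans (H∘f _) (⟦⟧-zero (chainSlack chain)))

    open Lattice H H≥0 public using (FaceIn)
    open Lattice H H≥0 using (face-in-hyperplane)

    supporting-ineq : ¬ ¬ ∃ λ t → Valid _≺_ t × FaceIn t
    supporting-ineq = face-in-hyperplane (σ zero) λ H[𝟙B]≡0 →
      contradiction (trans (sym H[𝟙B]≡1) H[𝟙B]≡0) λ ()

    module _ {t} (valid : Valid _≺_ t) (faceIn : FaceIn t) where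

      G-on-facet : ∀ x z → (∀ i → x i ≡ ℤ→ℚ (z i)) → InChainPolytope levelPoset x →
                   ⟦ chainSlack chain ⟧ x ≡ 0ℚ → ⟦ G t ⟧ x ≡ 0ℚ
      G-on-facet x z x≡z x∈𝒞 L[x]≡0 with f-integral x z x≡z x∈𝒞
      ... | D , D↓ , fx≡𝟙D = begin
        ⟦ G t ⟧ x        ≡⟨ ⟦G⟧ t x ⟩
        slackAt t (f x)  ≡⟨ slackAt-cong t fx≡𝟙D ⟩
        slackAt t (𝟙 D)  ≡⟨ slackAt-on D↓ t valid (faceIn D (D↓ , H[𝟙D]≡0)) ⟩
        0ℚ               ∎
        where
        open ≡-Reasoning
        H[𝟙D]≡0 : ⟦ H ⟧ (𝟙 D) ≡ 0ℚ
        H[𝟙D]≡0 = trans (sym (⟦⟧-cong H fx≡𝟙D)) (trans (H∘f x) L[x]≡0)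

      on-chain : ∀ {c} → chain c ≡ true → const (G t) + coeff (G t) c ≡ 0ℚ
      on-chain {c} c∈chain = trans (sym (⟦⟧-e (G t) c))
        (G-on-facet (e c) (δ c) (λ _ → refl) (e∈chainPolytope c)
          (trans (⟦⟧-e (chainSlack chain) c) (cong (λ b → 1ℚ + - (if b then 1ℚ else 0ℚ)) c∈chain)))

      off-chain : ∀ {p} → chain p ≡ false → coeff (G t) p ≡ 0ℚ
      off-chain {p} p∉chain = begin
        coeff (G t) p                                      ≡˘⟨ ℚ.+-identityˡ _ ⟩
        0ℚ + coeff (G t) p                                 ≡˘⟨ cong (_+ coeff (G t) p) (on-chain c∈chain) ⟩
        (const (G t) + coeff (G t) c) + coeff (G t) p      ≡˘⟨ ⟦⟧-e+e (G t) c p ⟩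
        ⟦ G t ⟧ (λ i → e c i + e p i)                      ≡⟨ G-on-facet _ (λ i → δ c i ℤ.+ δ p i)
                                                                (λ i → sym (ℤ→ℚ-homo-+ (δ c i) (δ p i)))
                                                                (e+e∈chainPolytope c∥p) L[e+e]≡0 ⟩
        0ℚ                                                 ∎
        where
        open ≡-Reasoning
        c = σ (level p)
        c∈chain : chain c ≡ true
        c∈chain = σ∈chain (level p)
        c∥p : ¬ Comparable levelPoset c p
        c∥p = same-level⇒incomparable (σ-section (level p)) (∉chain⇒ p∉chain)
        L[e+e]≡0 : ⟦ chainSlack chain ⟧ (λ i → e c i + e p i) ≡ 0ℚ
        L[e+e]≡0 = trans (⟦⟧-e+e (chainSlack chain) c p)
          (cong₂ (λ b b′ → (1ℚ + - (if b then 1ℚ else 0ℚ)) + - (if b′ then 1ℚ else 0ℚ)) c∈chain p∉chain)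

      const≢0 : const (G t) ≢ 0ℚ
      const≢0 const≡0 = G≢0 {t} valid const≡0 coeff≡0
        where
        coeff≡0 : ∀ p → coeff (G t) p ≡ 0ℚ
        coeff≡0 p with chain p in p∈?chain
        ... | true  = trans (sym (ℚ.+-identityˡ _))
                            (trans (cong (_+ coeff (G t) p) (sym const≡0)) (on-chain p∈?chain))
        ... | false = off-chain p∈?chain

      off-B : ¬ ¬ Off t B
      off-B ¬off = const≢0 (trans (const-G t) (slackAt-on (proj₁ (proj₂ base)) t valid ¬off))

  -- If σ ℓ ≢ σ′ ℓ then σ′ ℓ is off the chain of σ, so its coefficient in G t is 0 by σ and
  -- − const (G t) by σ′.
  sections-agree : ∀ {σ σ′} σ-section σ′-section {t} (valid : Valid _≺_ t) →
                   AtSection.FaceIn σ σ-section t → AtSection.FaceIn σ′ σ′-section t → ∀ ℓ → σ ℓ ≡ σ′ ℓ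
  sections-agree {σ} {σ′} σ-section σ′-section {t} valid faceIn faceIn′ ℓ with σ ℓ ≟ σ′ ℓ
  ... | yes σℓ≡σ′ℓ = σℓ≡σ′ℓ
  ... | no  σℓ≢σ′ℓ = ⊥-elim (AtSection.const≢0 σ σ-section {t} valid faceIn (begin
    const (G t)                       ≡˘⟨ ℚ.+-identityʳ _ ⟩
    const (G t) + 0ℚ                  ≡˘⟨ cong (_+_ (const (G t))) (off-chain σ σ-section valid faceIn c∉σ) ⟩
    const (G t) + coeff (G t) (σ′ ℓ)  ≡⟨ on-chain σ′ σ′-section valid faceIn′ (σ∈chain σ′ σ′-section ℓ) ⟩
    0ℚ                                ∎))
    where
    open ≡-Reasoning
    open AtSection using (on-chain; off-chain)
    open LevelPosets.Section level using (chain; σ∈chain; ≢⇒∉chain)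
    c∉σ : chain σ σ-section (σ′ ℓ) ≡ false
    c∉σ = ≢⇒∉chain σ σ-section λ σ[lσ′ℓ]≡σ′ℓ → σℓ≢σ′ℓ (trans (cong σ (sym (σ′-section ℓ))) σ[lσ′ℓ]≡σ′ℓ)

  impossible : ∀ {N} (section : Fin N → Fin (suc r) → Fin d) → (∀ s ℓ → level (section s ℓ) ≡ ℓ) →
               (∀ {s s′} → (∀ ℓ → section s ℓ ≡ section s′ ℓ) → s ≡ s′) →
               d ℕ.< N → (∀ k l → k ℕ.+ l ≡ d → suc (k ℕ.* l) ℕ.< N) → ⊥
  impossible {N} section level-section section-injective d<N kl<N = choices (too-many ∘ count)
    where
    Supported : Fin N → Set
    Supported s = ∃ λ t → Valid _≺_ t × AtSection.FaceIn (section s) (level-section s) t × Off t B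

    choices : ¬ ¬ (∀ s → Supported s)
    choices = ¬¬-Π-Fin λ s → do
      (t , valid , faceIn) ← AtSection.supporting-ineq (section s) (level-section s)
      off ← AtSection.off-B (section s) (level-section s) valid faceIn
      pure (t , valid , faceIn , off)

    count : (∀ s → Supported s) → N ℕ.≤ d ⊎ ∃₂ λ k l → k ℕ.+ l ≡ d × N ℕ.≤ suc (k ℕ.* l)
    count choice = good-count _≺_ B (proj₁ ∘ choice) injective good
      where
      injective : Injective _≡_ _≡_ (proj₁ ∘ choice)
      injective {s} {s′} eq with choice s | choice s′ | eq
      ... | _ , valid , faceIn , _ | _ , _ , faceIn′ , _ | refl =
        section-injective (sections-agree (level-section s) (level-section s′) valid faceIn faceIn′)
      good : ∀ s → Good _≺_ B (proj₁ (choice s))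
      good s with choice s
      ... | _ , valid , _ , off = valid , off

    too-many : N ℕ.≤ d ⊎ ∃₂ (λ k l → k ℕ.+ l ≡ d × N ℕ.≤ suc (k ℕ.* l)) → ⊥
    too-many (inj₁ N≤d)                     = ℕ.<⇒≱ d<N N≤d
    too-many (inj₂ (k , l , k+l≡d , N≤1+kl)) = ℕ.<⇒≱ (kl<N k l k+l≡d) N≤1+kl

module ThreeLevels (a b c : ℕ) where

  open import Data.Nat using (_+_; _*_)
  open import Data.Fin using (_↑ˡ_; _↑ʳ_; splitAt; combine; remQuot)
  open import Data.Fin.Patterns using (0F; 1F; 2F)
  open import Data.Fin.Properties using (splitAt-↑ˡ; splitAt-↑ʳ; ↑ˡ-injective; ↑ʳ-injective; combine-remQuot)
  open import Data.Product using (_×_; _,_; proj₁; proj₂)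
  open import Data.Sum using ([_,_]′)
  open import Relation.Binary.PropositionalEquality

  level : Fin (a + (b + c)) → Fin 3
  level i = [ (λ _ → 0F) , (λ j → [ (λ _ → 1F) , (λ _ → 2F) ]′ (splitAt b j)) ]′ (splitAt a i)

  pick : Fin a × Fin b × Fin c → Fin 3 → Fin (a + (b + c))
  pick (x , y , z) 0F = x ↑ˡ (b + c)
  pick (x , y , z) 1F = a ↑ʳ (y ↑ˡ c)
  pick (x , y , z) 2F = a ↑ʳ (b ↑ʳ z)

  level-pick : ∀ σ ℓ → level (pick σ ℓ) ≡ ℓ
  level-pick (x , y , z) 0F rewrite splitAt-↑ˡ a x (b + c) = refl
  level-pick (x , y , z) 1F rewrite splitAt-↑ʳ a (b + c) (y ↑ˡ c) | splitAt-↑ˡ b y c = refl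
  level-pick (x , y , z) 2F rewrite splitAt-↑ʳ a (b + c) (b ↑ʳ z) | splitAt-↑ʳ b c z = refl

  pick-injective : ∀ {σ σ′} → (∀ ℓ → pick σ ℓ ≡ pick σ′ ℓ) → σ ≡ σ′
  pick-injective {x , y , z} {x′ , y′ , z′} same
    rewrite ↑ˡ-injective (b + c) x x′ (same 0F)
          | ↑ˡ-injective c y y′ (↑ʳ-injective a _ _ (same 1F))
          | ↑ʳ-injective b z z′ (↑ʳ-injective a _ _ (same 2F)) = refl

  decode : Fin (a * (b * c)) → Fin a × Fin b × Fin c
  decode s = let x , t = remQuot (b * c) s in x , remQuot c t

  decode-injective : ∀ {s s′} → decode s ≡ decode s′ → s ≡ s′
  decode-injective {s} {s′} eq = trans (sym (encode∘decode s)) (trans (cong encode eq) (encode∘decode s′))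
    where
    encode : Fin a × Fin b × Fin c → Fin (a * (b * c))
    encode (x , y , z) = combine x (combine y z)
    encode∘decode : ∀ s → encode (decode s) ≡ s
    encode∘decode s = trans (cong (combine x) (combine-remQuot {b} c t)) (combine-remQuot {a} (b * c) s)
      where
      x = proj₁ (remQuot {a} (b * c) s)
      t = proj₂ (remQuot {a} (b * c) s)

  section : Fin (a * (b * c)) → Fin 3 → Fin (a + (b + c))
  section s = pick (decode s)

  level-section : ∀ s ℓ → level (section s ℓ) ≡ ℓ
  level-section s = level-pick (decode s)

  section-injective : ∀ {s s′} → (∀ ℓ → section s ℓ ≡ section s′ ℓ) → s ≡ s′
  section-injective same = decode-injective (pick-injective same)

module Arithmetic where

  open import Data.Nat
  open import Data.Nat.Properties
  open import Data.Nat.DivMod using (_/_; _%_; m≡m%n+[m/n]*n; m%n<n; /-monoˡ-≤)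
  open import Data.Nat.Tactic.RingSolver using (solve-∀)
  open import Data.Product using (∃; _×_; _,_)
  open import Data.Sum using (inj₁; inj₂)
  open import Relation.Binary.PropositionalEquality

  4kl≤[k+l]² : ∀ k l → 4 * (k * l) ≤ (k + l) * (k + l)
  4kl≤[k+l]² k l with ≤-total k l
  ... | inj₁ k≤l with m≤n⇒∃[o]m+o≡n k≤l
  ...   | e , refl = subst (4 * (k * (k + e)) ≤_) (identity k e) (m≤m+n _ (e * e))
    where
    identity : ∀ k e → 4 * (k * (k + e)) + e * e ≡ (k + (k + e)) * (k + (k + e))
    identity = solve-∀
  4kl≤[k+l]² k l | inj₂ l≤k with m≤n⇒∃[o]m+o≡n l≤k
  ...   | e , refl = subst (4 * ((l + e) * l) ≤_) (identity l e) (m≤m+n _ (e * e))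
    where
    identity : ∀ l e → 4 * ((l + e) * l) + e * e ≡ ((l + e) + l) * ((l + e) + l)
    identity = solve-∀

  square-bound : ∀ {d N} → 4 ≤ d → d * d + 4 < 4 * N → d < N × (∀ k l → k + l ≡ d → suc (k * l) < N)
  square-bound {d} {N} 4≤d d²+4<4N = *-cancelˡ-< 4 d N 4d<4N , kl<N
    where
    open ≤-Reasoning
    4d<4N : 4 * d < 4 * N
    4d<4N = begin-strict
      4 * d      ≤⟨ *-monoˡ-≤ d 4≤d ⟩
      d * d      <⟨ m<m+n (d * d) (s≤s z≤n) ⟩
      d * d + 4  <⟨ d²+4<4N ⟩
      4 * N      ∎
    kl<N : ∀ k l → k + l ≡ d → suc (k * l) < N
    kl<N k l refl = *-cancelˡ-< 4 (suc (k * l)) N (begin-strict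
      4 * suc (k * l)        ≡⟨ *-suc 4 (k * l) ⟩
      4 + 4 * (k * l)        ≤⟨ +-monoʳ-≤ 4 (4kl≤[k+l]² k l) ⟩
      4 + (k + l) * (k + l)  ≡⟨ +-comm 4 _ ⟩
      (k + l) * (k + l) + 4  <⟨ d²+4<4N ⟩
      4 * N                  ∎)

  excess⇒< : ∀ {m n} e → n ≡ suc (m + e) → m < n
  excess⇒< {m} e refl = s≤s (m≤m+n m e)

  balanced : ∀ {q} r → 3 ≤ q → r ≤ 2 →
             (q + (q + (q + r))) * (q + (q + (q + r))) + 4 < 4 * (q * (q * (q + r)))
  balanced {q} r 3≤q r≤2 with m≤n⇒∃[o]m+o≡n 3≤q
  ... | n , refl = by-remainder r r≤2
    where
    -- each excess is 4q²(q + r) − (3q + r)² − 5 expanded in n = q − 3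
    by-remainder : ∀ r → r ≤ 2 → let q = 3 + n ; d = q + (q + (q + r)) in d * d + 4 < 4 * (q * (q * (q + r)))
    by-remainder 0 _ = excess⇒< (22 + 54 * n + 27 * n * n + 4 * n * n * n) (identity n)
      where
      identity : ∀ n → 4 * ((3 + n) * ((3 + n) * (3 + n + 0))) ≡
        suc (((3 + n) + ((3 + n) + (3 + n + 0))) * ((3 + n) + ((3 + n) + (3 + n + 0))) + 4 +
             (22 + 54 * n + 27 * n * n + 4 * n * n * n))
      identity = solve-∀
    by-remainder 1 _ = excess⇒< (39 + 72 * n + 31 * n * n + 4 * n * n * n) (identity n)
      where
      identity : ∀ n → 4 * ((3 + n) * ((3 + n) * (3 + n + 1))) ≡
        suc (((3 + n) + ((3 + n) + (3 + n + 1))) * ((3 + n) + ((3 + n) + (3 + n + 1))) + 4 +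
             (39 + 72 * n + 31 * n * n + 4 * n * n * n))
      identity = solve-∀
    by-remainder 2 _ = excess⇒< (54 + 90 * n + 35 * n * n + 4 * n * n * n) (identity n)
      where
      identity : ∀ n → 4 * ((3 + n) * ((3 + n) * (3 + n + 2))) ≡
        suc (((3 + n) + ((3 + n) + (3 + n + 2))) * ((3 + n) + ((3 + n) + (3 + n + 2))) + 4 +
             (54 + 90 * n + 35 * n * n + 4 * n * n * n))
      identity = solve-∀
    by-remainder (suc (suc (suc _))) (s≤s (s≤s ()))

  balanced-split : ∀ d → 9 ≤ d → ∃ λ ((a , b , c) : ℕ × ℕ × ℕ) → d ≡ a + (b + c) × d * d + 4 < 4 * (a * (b * c))
  balanced-split d 9≤d with m%n<n d 3
  ... | s≤s r≤2 = (q , q , q + r) , d≡ , subst (λ d → d * d + 4 < 4 * (q * (q * (q + r)))) (sym d≡)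
                                               (balanced r (/-monoˡ-≤ 3 9≤d) r≤2)
    where
    q = d / 3
    r = d % 3
    d≡ : d ≡ q + (q + (q + r))
    d≡ = trans (m≡m%n+[m/n]*n d 3) (identity r q)
      where
      identity : ∀ r q → r + q * 3 ≡ q + (q + (q + r))
      identity = solve-∀

  enough-chains : ∀ d → 9 ≤ d → ∃ λ ((a , b , c) : ℕ × ℕ × ℕ) → let N = a * (b * c) in
                  d ≡ a + (b + c) × d < N × (∀ k l → k + l ≡ d → suc (k * l) < N)
  enough-chains d 9≤d with balanced-split d 9≤d
  ... | abc , d≡a+b+c , d²+4<4N = abc , d≡a+b+c , square-bound (≤-trans (m≤m+n 4 5) 9≤d) d²+4<4N

open import Data.Nat using (_≤_)
open import Data.Product using (Σ; _,_)
open import Relation.Nullary using (¬_)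
open import Relation.Nullary.Decidable using (¬¬-excluded-middle)
open DoubleNegation using (¬¬-Π-Fin)
open LevelPosets using (levelPoset)
import Data.Nat as ℕ

levelPoset-chainPolytope≇orderPolytope :
  ∀ {d r N} (level : Fin d → Fin (suc r)) (section : Fin N → Fin (suc r) → Fin d) →
  (∀ s ℓ → level (section s ℓ) ≡ ℓ) → (∀ {s s′} → (∀ ℓ → section s ℓ ≡ section s′ ℓ) → s ≡ s′) →
  d ℕ.< N → (∀ k l → k ℕ.+ l ≡ d → suc (k ℕ.* l) ℕ.< N) →
  ∀ Q → ¬ UnimodularlyEquivalent (InChainPolytope (levelPoset level)) (InOrderPolytope Q)
levelPoset-chainPolytope≇orderPolytope level section level-section section-injective d<N kl<N Q
  (U , b , (V , _ , V⊗U≡I) , f-onto) = order-decidable λ _≼?_ →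
    Obstruction.impossible level Q _≼?_ U V b V⊗U≡I f-onto section level-section section-injective d<N kl<N
  where
  order-decidable : ¬ ¬ Decidable (FinPoset._≼_ Q)
  order-decidable = ¬¬-Π-Fin λ i → ¬¬-Π-Fin λ j → ¬¬-excluded-middle

corollary3p9 : (d : ℕ) → 9 ≤ d →
    Σ (FinPoset d) λ P → (Q : FinPoset d) →
      ¬ UnimodularlyEquivalent (InChainPolytope P) (InOrderPolytope Q)
corollary3p9 d 9≤d with Arithmetic.enough-chains d 9≤d
... | (a , b , c) , refl , d<abc , kl<abc =
  levelPoset level ,
  levelPoset-chainPolytope≇orderPolytope level section level-section section-injective d<abc kl<abc
  where open ThreeLevels a b c
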